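{- Let $p$ be a prime, $n\ge2$, $q=p^n$. Given $\vec b=(b_0,\dots,b_{n-1})\in(\mathbb{Z}/2)^n$, let $\vec b^{\rm aug}=(1,b_0,\dots,b_{n-2},0)$, and let $n_s$ (resp. $n_d$) be the number of pairs of adjacent entries of $\vec b^{\rm aug}$ that are equal (resp. different). Then $\dim_k H^1_{\rm dR}(X_q)_{\vec b}=\left(\frac{p(p+1)}{2}\right)^{n_s}\left(\frac{p(p-1)}{2}\right)^{n_d}$.
   Context: $k$ is an algebraically closed field of characteristic $p$ and $X_q$ is the Hermitian curve $y^q+y=x^{q+1}$ over $k$. Let $\Delta=\{(i,j)\in\mathbb{Z}^2:i,j\ge0,i+j\le q-2\}$. $H^1_{\rm dR}(X_q)$ has a basis consisting of the classes $\omega_{i,j}$ of the regular differentials $x^iy^jdx$, $(i,j)\in\Delta$, together with classes $\tilde f_{i,j}$, $(i,j)\in\Delta$, lifting the basis $f_{i,j}=\frac{y^{q-1}}{x^{i+1}y^j}$ of $H^1(X_q,\mathcal{O})$ (Čech cohomology for the cover $X_q\setminus\{P_\infty\}$, $X_q\setminus\{x=0\}$). For $0\le m<p^n$ write $m=\sum m_lp^l$ ($0\le m_l\le p-1$), $m^+_h=\sum_{l=0}^{h-1}m_lp^l$. For $(i,j)\in\Delta$, $0\le h\le n-2$: $b_h(i,j)=0$ if $i^+_{h+1}+j^+_{h+1}<p^{h+1}-1$, else $1$. The vector of $\omega_{i,j}$ is $(b_0(i,j),\dots,b_{n-2}(i,j),1)$ and of $\tilde f_{i,j}$ is $(b_0(i,j),\dots,b_{n-2}(i,j),0)$.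 $H^1_{\rm dR}(X_q)_{\vec b}$ is the $k$-span of the basis elements with vector $\vec b$. -}

module Defs where

open import Data.Nat using (ℕ; zero; suc; _+_; _*_; _∸_; _^_; _<_; _≤?_; _<?_)
open import Data.Nat.DivMod using (_/_; _%_)
open import Data.Bool using (Bool; true; false; if_then_else_; not)
import Data.Bool.Properties as BoolP
open import Data.List using (List; []; _∷_; map; concatMap; upTo; filter; length; take; _++_)
open import Data.Vec using (Vec; tabulate; toList)
import Data.Vec.Properties as VecP
open import Data.Fin using (Fin; toℕ)
open import Data.Product using (_×_; _,_)
open import Relation.Nullary.Decidable using (does)

-- base-p digit m_l of m (digit p l m); convention: for p = 0 everything is 0
digit : ℕ → ℕ → ℕ → ℕ
digit zero    l       m = 0
digit (suc p) zero    m = m % suc p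
digit (suc p) (suc l) m = digit (suc p) l (m / suc p)

plus : ℕ → ℕ → ℕ → ℕ
plus p zero    m = 0
plus p (suc h) m = plus p h m + digit p h m * p ^ h

-- b_h(i,j) ∈ ℤ/2 (true = 1): 0 iff i⁺_{h+1} + j⁺_{h+1} < p^{h+1} - 1
bh : ℕ → ℕ → ℕ → ℕ → Bool
bh p h i j = not (does (plus p (suc h) i + plus p (suc h) j <? p ^ suc h ∸ 1))

-- Δ = {(i,j) : i,j ≥ 0, i + j ≤ q - 2}, enumerated without repetition
Δ : ℕ → List (ℕ × ℕ)
Δ q = concatMap (λ i → map (λ j → (i , j)) (upTo (q ∸ 1 ∸ i))) (upTo (q ∸ 1))

-- basis elements of H¹_dR(X_q): (true , (i,j)) is ω_{i,j}, (false , (i,j)) is f̃_{i,j}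
Basis : ℕ → List (Bool × (ℕ × ℕ))
Basis q = map (λ ij → (true , ij)) (Δ q) ++ map (λ ij → (false , ij)) (Δ q)

-- the vector (b_0(i,j), …, b_{n-2}(i,j), last) of a basis element, last = 1 for ω, 0 for f̃
basisVec : (p n : ℕ) → Bool × (ℕ × ℕ) → Vec Bool n
basisVec p n (t , (i , j)) =
  tabulate (λ (h : Fin n) → if does (suc (toℕ h) ≤? n ∸ 1) then bh p (toℕ h) i j else t)

-- dim_k H¹_dR(X_q)_b = number of basis elements with vector b
dimPiece : (p n : ℕ) → Vec Bool n → ℕ
dimPiece p n b = length (filter (λ e → VecP.≡-dec BoolP._≟_ (basisVec p n e) b) (Basis (p ^ n)))

aug : (n : ℕ) → Vec Bool n → List Bool
aug n b = true ∷ (take (n ∸ 1) (toList b) ++ (false ∷ []))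

nSame : List Bool → ℕ
nSame (x ∷ y ∷ r) = (if does (x BoolP.≟ y) then 1 else 0) + nSame (y ∷ r)
nSame _ = 0

nDiff : List Bool → ℕ
nDiff (x ∷ y ∷ r) = (if does (x BoolP.≟ y) then 0 else 1) + nDiff (y ∷ r)
nDiff _ = 0

module Submission where

-- Write P = p and q = P ^ n with n = N + 1.  The basis element over (i , j) ∈ Δ has
-- b_h(i , j) = 1 exactly when adding i + j + 1 in base P carries out of digit h, so the
-- theorem is a count of carry patterns:
--   1. of ω_{i,j} and f̃_{i,j} exactly one has the prescribed last entry, so the dimension
--      counts the (i , j) ∈ Δ whose carries out of digits 0 … N - 1 are b_0 … b_{N-1};
--   2. (i , j) ∈ Δ means that i + j + 1 has no carry out of the top digit N, so the count is
--      over all (i , j) ∈ [0 , q)² with carry sequence w = (b_0 , … , b_{N-1} , 0);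
--   3. the carry out of a digit depends only on the two digits and the incoming carry, so
--      this count is the product over the adjacent pairs (e , x) of (1 , w) = b^aug of the
--      number of digit pairs a , c < P for which a + c + e carries x;
--   4. that number is P(P+1)/2 if e = x and P(P-1)/2 otherwise.
-- The file develops finite sums and counting along lists, the digit counts of step 4 with
-- the resulting product (weight), base-P carries with the product formula of step 3, the
-- basis vectors, and then steps 1-2 for every base P ≥ 1 and n ≥ 1; Lemma 4.2 is the case
-- of a prime P and n ≥ 2.

open import Defs
open import Data.Nat using (ℕ; _≤_; _*_; _^_; _+_; _∸_)
open import Data.Nat.DivMod using (_/_)
open import Data.Nat.Primality using (Prime)
open import Data.Bool using (Bool)
open import Data.Vec using (Vec)
open import Relation.Binary.PropositionalEquality using (_≡_)

open import Data.Nat using (zero; suc; _<_; _⊓_; _≤?_; _<?_; z≤n; s≤s; s≤s⁻¹; ≢-nonZero⁻¹)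
open import Data.Nat.Properties
open import Data.Nat.DivMod using (_%_; m*n/n≡m; m%n<n; m<n⇒m%n≡m; m<n⇒m/n≡0; [m+kn]%n≡m%n;
  +-distrib-/; m*n%n≡0; m≡m%n+[m/n]*n; m<n*o⇒m/o<n)
open import Data.Nat.Primality using (prime⇒nonZero)
open import Data.Nat.Solver using (module +-*-Solver)
open import Data.Bool using (true; false; not; _∧_; if_then_else_)
import Data.Bool.Properties as Boolₚ
open import Data.List using (List; []; _∷_; length; map; concatMap; applyUpTo; filter; take; _++_)
import Data.List.Properties as Listₚ
open import Data.Vec using (tabulate; toList) renaming (_∷_ to _∷ᵥ_; [] to []ᵥ)
import Data.Vec.Properties as Vecₚ
open import Data.Fin using (Fin; toℕ) renaming (suc to fsuc)
open import Data.Product using (_×_; _,_)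
open import Data.Empty using (⊥-elim)
open import Function using (_∘_; _⇔_; mk⇔)
open import Relation.Nullary using (Dec; yes; no; does; ¬_; ¬?)
open import Relation.Nullary.Decidable using (does-⇔; dec-true; dec-false)
open import Relation.Binary.PropositionalEquality using (refl; sym; trans; cong; cong₂; subst; module ≡-Reasoning)
open import Algebra.Properties.CommutativeSemigroup +-commutativeSemigroup
  using (interchange) renaming (x∙yz≈y∙xz to x+[y+z]≡y+[x+z])
open import Algebra.Properties.CommutativeSemigroup *-commutativeSemigroup
  using () renaming (x∙yz≈y∙xz to x*[y*z]≡y*[x*z])

-- Booleans counted as 0/1, and the Boolean equality test.  Matching on the second
-- argument makes  y == true = y  and  y == false = not y  hold by computation.
bit : Bool → ℕ
bit true  = 1
bit false = 0

_==_ : Bool → Bool → Bool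
y == true  = y
y == false = not y

-- In (y == x) ∧ Q y the second conjunct only matters when y equals x, so the
-- indicator factorises with Q evaluated at x.
bit-==-∧ : ∀ y x (Q : Bool → Bool) → bit ((y == x) ∧ Q y) ≡ bit (y == x) * bit (Q x)
bit-==-∧ true  true  Q = sym (+-identityʳ _)
bit-==-∧ true  false Q = refl
bit-==-∧ false true  Q = refl
bit-==-∧ false false Q = sym (+-identityʳ _)

sumTo : ℕ → (ℕ → ℕ) → ℕ
sumTo zero    f = 0
sumTo (suc n) f = f 0 + sumTo n (f ∘ suc)

sum-cong : ∀ n {f g : ℕ → ℕ} → (∀ i → i < n → f i ≡ g i) → sumTo n f ≡ sumTo n g
sum-cong zero    f≗g = refl
sum-cong (suc n) f≗g = cong₂ _+_ (f≗g 0 (s≤s z≤n)) (sum-cong n (λ i i<n → f≗g (suc i) (s≤s i<n)))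

sum-zero : ∀ n {f : ℕ → ℕ} → (∀ i → i < n → f i ≡ 0) → sumTo n f ≡ 0
sum-zero zero    f≗0 = refl
sum-zero (suc n) f≗0 = cong₂ _+_ (f≗0 0 (s≤s z≤n)) (sum-zero n (λ i i<n → f≗0 (suc i) (s≤s i<n)))

sum-ones : ∀ n → sumTo n (λ _ → 1) ≡ n
sum-ones zero    = refl
sum-ones (suc n) = cong suc (sum-ones n)

sum-+ : ∀ n (f g : ℕ → ℕ) → sumTo n (λ i → f i + g i) ≡ sumTo n f + sumTo n g
sum-+ zero    f g = refl
sum-+ (suc n) f g = trans (cong (f 0 + g 0 +_) (sum-+ n (f ∘ suc) (g ∘ suc)))
                          (interchange (f 0) (g 0) _ _)

sum-*ʳ : ∀ n (f : ℕ → ℕ) c → sumTo n (λ i → f i * c) ≡ sumTo n f * c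
sum-*ʳ zero    f c = refl
sum-*ʳ (suc n) f c = trans (cong (f 0 * c +_) (sum-*ʳ n (f ∘ suc) c)) (sym (*-distribʳ-+ c (f 0) _))

sum-*ˡ : ∀ n (f : ℕ → ℕ) c → sumTo n (λ i → c * f i) ≡ c * sumTo n f
sum-*ˡ n f c = trans (sum-cong n (λ i _ → *-comm c (f i))) (trans (sum-*ʳ n f c) (*-comm _ c))

sum-swap : ∀ m n (f : ℕ → ℕ → ℕ) →
  sumTo m (λ a → sumTo n (f a)) ≡ sumTo n (λ b → sumTo m (λ a → f a b))
sum-swap zero    n f = sym (sum-zero n (λ _ _ → refl))
sum-swap (suc m) n f = trans (cong (sumTo n (f 0) +_) (sum-swap m n (f ∘ suc)))
                             (sym (sum-+ n (f 0) (λ b → sumTo m (λ a → f (suc a) b))))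

sum-split : ∀ m n (f : ℕ → ℕ) → sumTo (m + n) f ≡ sumTo m f + sumTo n (λ i → f (m + i))
sum-split zero    n f = refl
sum-split (suc m) n f = trans (cong (f 0 +_) (sum-split m n (f ∘ suc))) (sym (+-assoc (f 0) _ _))

sum-last : ∀ n (f : ℕ → ℕ) → sumTo (suc n) f ≡ sumTo n f + f n
sum-last n f = begin
    sumTo (suc n) f                      ≡⟨ cong (λ k → sumTo k f) (+-comm 1 n) ⟩
    sumTo (n + 1) f                      ≡⟨ sum-split n 1 f ⟩
    sumTo n f + (f (n + 0) + 0)          ≡⟨ cong (λ k → sumTo n f + k) (+-identityʳ _) ⟩
    sumTo n f + f (n + 0)                ≡⟨ cong (λ k → sumTo n f + f k) (+-identityʳ n) ⟩
    sumTo n f + f n                      ∎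
  where open ≡-Reasoning

sum-blocks : ∀ K P (f : ℕ → ℕ) → sumTo (K * P) f ≡ sumTo K (λ i → sumTo P (λ a → f (a + i * P)))
sum-blocks zero    P f = refl
sum-blocks (suc K) P f = begin
    sumTo (P + K * P) f
  ≡⟨ sum-split P (K * P) f ⟩
    sumTo P f + sumTo (K * P) (λ i → f (P + i))
  ≡⟨ cong₂ _+_ (sum-cong P (λ a _ → cong f (sym (+-identityʳ a)))) (sum-blocks K P (λ i → f (P + i))) ⟩
    sumTo P (λ a → f (a + 0)) + sumTo K (λ i → sumTo P (λ a → f (P + (a + i * P))))
  ≡⟨ cong (sumTo P (λ a → f (a + 0)) +_)
       (sum-cong K (λ i _ → sum-cong P (λ a _ → cong f (x+[y+z]≡y+[x+z] P a (i * P))))) ⟩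
    sumTo P (λ a → f (a + 0)) + sumTo K (λ i → sumTo P (λ a → f (a + suc i * P))) ∎
  where open ≡-Reasoning

sum-truncate : ∀ M N (f : ℕ → ℕ) → M ≤ N → (∀ i → M ≤ i → i < N → f i ≡ 0) → sumTo N f ≡ sumTo M f
sum-truncate M N f M≤N tail≗0 = begin
    sumTo N f                                      ≡⟨ cong (λ k → sumTo k f) (sym (m+[n∸m]≡n M≤N)) ⟩
    sumTo (M + (N ∸ M)) f                          ≡⟨ sum-split M (N ∸ M) f ⟩
    sumTo M f + sumTo (N ∸ M) (λ i → f (M + i))    ≡⟨ cong (sumTo M f +_) (sum-zero (N ∸ M) tail) ⟩
    sumTo M f + 0                                  ≡⟨ +-identityʳ _ ⟩
    sumTo M f                                      ∎
  where
  open ≡-Reasoning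
  tail : ∀ i → i < N ∸ M → f (M + i) ≡ 0
  tail i i< = tail≗0 (M + i) (m≤m+n M i) (subst (M + i <_) (m+[n∸m]≡n M≤N) (+-monoʳ-< M i<))

sum² : ℕ → (ℕ → ℕ → ℕ) → ℕ
sum² n f = sumTo n (λ i → sumTo n (f i))

sum²-cong : ∀ n {f g : ℕ → ℕ → ℕ} → (∀ i j → i < n → j < n → f i j ≡ g i j) → sum² n f ≡ sum² n g
sum²-cong n f≗g = sum-cong n (λ i i<n → sum-cong n (λ j j<n → f≗g i j i<n j<n))

sum²-blocks : ∀ K P (f : ℕ → ℕ → ℕ) →
  sum² (K * P) f ≡ sum² K (λ i′ j′ → sum² P (λ a c → f (a + i′ * P) (c + j′ * P)))
sum²-blocks K P f = begin
    sumTo (K * P) (λ i → sumTo (K * P) (f i))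
  ≡⟨ sum-blocks K P (λ i → sumTo (K * P) (f i)) ⟩
    sumTo K (λ i′ → sumTo P (λ a → sumTo (K * P) (f (a + i′ * P))))
  ≡⟨ sum-cong K (λ i′ _ → sum-cong P (λ a _ → sum-blocks K P (f (a + i′ * P)))) ⟩
    sumTo K (λ i′ → sumTo P (λ a → sumTo K (λ j′ → sumTo P (λ c → f (a + i′ * P) (c + j′ * P)))))
  ≡⟨ sum-cong K (λ i′ _ → sum-swap P K _) ⟩
    sum² K (λ i′ j′ → sum² P (λ a c → f (a + i′ * P) (c + j′ * P))) ∎
  where open ≡-Reasoning

sum²-product : ∀ M N (t u : ℕ → ℕ → ℕ) →
  sum² M (λ i j → sum² N (λ a c → t a c * u i j)) ≡ sum² N t * sum² M u
sum²-product M N t u = begin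
    sum² M (λ i j → sum² N (λ a c → t a c * u i j))
  ≡⟨ sum²-cong M (λ i j _ _ → inner (u i j)) ⟩
    sum² M (λ i j → sum² N t * u i j)
  ≡⟨ sum-cong M (λ i _ → sum-*ˡ M (u i) (sum² N t)) ⟩
    sumTo M (λ i → sum² N t * sumTo M (u i))
  ≡⟨ sum-*ˡ M (λ i → sumTo M (u i)) (sum² N t) ⟩
    sum² N t * sum² M u ∎
  where
  open ≡-Reasoning
  inner : ∀ v → sum² N (λ a c → t a c * v) ≡ sum² N t * v
  inner v = trans (sum-cong N (λ a _ → sum-*ʳ N (t a) v)) (sum-*ʳ N (λ a → sumTo N (t a)) v)

count : ∀ {A : Set} → (A → Bool) → List A → ℕ
count f []       = 0
count f (x ∷ xs) = bit (f x) + count f xs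

count-filter : ∀ {A : Set} {P : A → Set} (P? : ∀ x → Dec (P x)) xs →
  length (filter P? xs) ≡ count (λ x → does (P? x)) xs
count-filter P? []       = refl
count-filter P? (x ∷ xs) with does (P? x)
... | true  = cong suc (count-filter P? xs)
... | false = count-filter P? xs

count-map : ∀ {A B : Set} (f : B → Bool) (k : A → B) xs → count f (map k xs) ≡ count (f ∘ k) xs
count-map f k []       = refl
count-map f k (x ∷ xs) = cong (bit (f (k x)) +_) (count-map f k xs)

count-++ : ∀ {A : Set} (f : A → Bool) xs ys → count f (xs ++ ys) ≡ count f xs + count f ys
count-++ f []       ys = refl
count-++ f (x ∷ xs) ys = trans (cong (bit (f x) +_) (count-++ f xs ys)) (sym (+-assoc (bit (f x)) _ _))

count-merge : ∀ {A : Set} (f g h : A → Bool) → (∀ x → bit (f x) + bit (g x) ≡ bit (h x)) →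
  ∀ xs → count f xs + count g xs ≡ count h xs
count-merge f g h f+g≗h []       = refl
count-merge f g h f+g≗h (x ∷ xs) =
  trans (interchange (bit (f x)) _ (bit (g x)) _) (cong₂ _+_ (f+g≗h x) (count-merge f g h f+g≗h xs))

count-applyUpTo : ∀ {A : Set} (f : A → Bool) (g : ℕ → A) n →
  count f (applyUpTo g n) ≡ sumTo n (λ i → bit (f (g i)))
count-applyUpTo f g zero    = refl
count-applyUpTo f g (suc n) = cong (bit (f (g 0)) +_) (count-applyUpTo f (g ∘ suc) n)

count-concatMap : ∀ {A : Set} (f : A → Bool) (h : ℕ → List A) (g : ℕ → ℕ) n →
  count f (concatMap h (applyUpTo g n)) ≡ sumTo n (λ i → count f (h (g i)))
count-concatMap f h g zero    = refl
count-concatMap f h g (suc n) =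
  trans (count-++ f (h (g 0)) _) (cong (count f (h (g 0)) +_) (count-concatMap f h (g ∘ suc) n))

count-Δ : (f : ℕ × ℕ → Bool) (q : ℕ) →
  count f (Δ q) ≡ sumTo (q ∸ 1) (λ i → sumTo (q ∸ 1 ∸ i) (λ j → bit (f (i , j))))
count-Δ f q = trans (count-concatMap f (λ i → map (i ,_) (applyUpTo (λ j → j) (q ∸ 1 ∸ i))) (λ i → i) (q ∸ 1))
  (sum-cong (q ∸ 1) (λ i _ → trans (count-map f (i ,_) (applyUpTo (λ j → j) (q ∸ 1 ∸ i)))
    (count-applyUpTo (λ j → f (i , j)) (λ j → j) (q ∸ 1 ∸ i))))

sum²-triangle : ∀ q (f g : ℕ → ℕ → ℕ) →
  (∀ i j → i < q → j < q → i + j < q ∸ 1 → g i j ≡ f i j) →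
  (∀ i j → i < q → j < q → q ∸ 1 ≤ i + j → f i j ≡ 0) →
  sumTo (q ∸ 1) (λ i → sumTo (q ∸ 1 ∸ i) (g i)) ≡ sum² q f
sum²-triangle q f g g≗f f≗0 = begin
    sumTo (q ∸ 1) (λ i → sumTo (q ∸ 1 ∸ i) (g i))
  ≡⟨ sum-cong (q ∸ 1) (λ i i< → sum-cong (q ∸ 1 ∸ i) (λ j j< →
       g≗f i j (below-q i<) (below-q (<-≤-trans j< (m∸n≤m (q ∸ 1) i))) (inside i< j<))) ⟩
    sumTo (q ∸ 1) (λ i → sumTo (q ∸ 1 ∸ i) (f i))
  ≡⟨ sum-cong (q ∸ 1) (λ i i< → sym (sum-truncate (q ∸ 1 ∸ i) q (f i)
       (≤-trans (m∸n≤m (q ∸ 1) i) (m∸n≤m q 1))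
       (λ j j≥ j<q → f≗0 i j (below-q i<) j<q (outside i< j≥)))) ⟩
    sumTo (q ∸ 1) (λ i → sumTo q (f i))
  ≡⟨ sym (sum-truncate (q ∸ 1) q (λ i → sumTo q (f i)) (m∸n≤m q 1)
       (λ i i≥ i<q → sum-zero q (λ j j<q → f≗0 i j i<q j<q (≤-trans i≥ (m≤m+n i j))))) ⟩
    sum² q f ∎
  where
  open ≡-Reasoning
  below-q : ∀ {k} → k < q ∸ 1 → k < q
  below-q k< = <-≤-trans k< (m∸n≤m q 1)
  inside : ∀ {i j} → i < q ∸ 1 → j < q ∸ 1 ∸ i → i + j < q ∸ 1
  inside {i} {j} i< j< = subst (i + j <_) (m+[n∸m]≡n (<⇒≤ i<)) (+-monoʳ-< i j<)
  outside : ∀ {i j} → i < q ∸ 1 → q ∸ 1 ∸ i ≤ j → q ∸ 1 ≤ i + j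
  outside {i} {j} i< j≥ = subst (_≤ i + j) (m+[n∸m]≡n (<⇒≤ i<)) (+-monoʳ-≤ i j≥)

tri : ℕ → ℕ
tri N = sumTo N suc

tri-double : ∀ N → tri N * 2 ≡ N * suc N
tri-double zero    = refl
tri-double (suc N) = begin
    tri (suc N) * 2                ≡⟨ cong (_* 2) (sum-last N suc) ⟩
    (tri N + suc N) * 2            ≡⟨ *-distribʳ-+ 2 (tri N) (suc N) ⟩
    tri N * 2 + suc N * 2          ≡⟨ cong (_+ suc N * 2) (trans (tri-double N) (*-comm N (suc N))) ⟩
    suc N * N + suc N * 2          ≡⟨ sym (*-distribˡ-+ (suc N) N 2) ⟩
    suc N * (N + 2)                ≡⟨ cong (suc N *_) (+-comm N 2) ⟩
    suc N * suc (suc N)            ∎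
  where open ≡-Reasoning

tri-above : ∀ P → (P * (P + 1)) / 2 ≡ tri P
tri-above P = trans (cong (_/ 2) (trans (cong (P *_) (+-comm P 1)) (sym (tri-double P)))) (m*n/n≡m (tri P) 2)

tri-below : ∀ P → (P * (P ∸ 1)) / 2 ≡ tri (P ∸ 1)
tri-below zero    = refl
tri-below (suc M) = trans (cong (_/ 2) (trans (*-comm (suc M) M) (sym (tri-double M)))) (m*n/n≡m (tri M) 2)

sum-id : ∀ N → sumTo N (λ a → a) ≡ tri (N ∸ 1)
sum-id zero    = refl
sum-id (suc N) = refl

sum-reversed : ∀ N → sumTo N (λ a → N ∸ a) ≡ tri N
sum-reversed zero    = refl
sum-reversed (suc N) = trans (cong (suc N +_) (sum-reversed N)) (trans (+-comm (suc N) (tri N)) (sym (sum-last N suc)))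

sum-reversed′ : ∀ N → sumTo N (λ a → N ∸ suc a) ≡ sumTo N (λ a → a)
sum-reversed′ zero    = refl
sum-reversed′ (suc N) = trans (cong (N +_) (sum-reversed′ N)) (trans (+-comm N _) (sym (sum-last N (λ a → a))))

≤?-suc : ∀ m n → does (suc m ≤? suc n) ≡ does (m ≤? n)
≤?-suc m n = does-⇔ (mk⇔ s≤s⁻¹ s≤s) (suc m ≤? suc n) (m ≤? n)

count-reaching : ∀ N r → sumTo N (λ c → bit (does (N ≤? c + r))) ≡ N ⊓ r
count-reaching zero    r = refl
count-reaching (suc N) r = begin
    bit (does (suc N ≤? r)) + sumTo N (λ c → bit (does (suc N ≤? suc c + r)))
  ≡⟨ cong (bit (does (suc N ≤? r)) +_)
       (trans (sum-cong N (λ c _ → cong bit (≤?-suc N (c + r)))) (count-reaching N r)) ⟩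
    bit (does (suc N ≤? r)) + N ⊓ r
  ≡⟨ first-term (suc N ≤? r) ⟩
    suc N ⊓ r ∎
  where
  open ≡-Reasoning
  first-term : (d : Dec (suc N ≤ r)) → bit (does d) + N ⊓ r ≡ suc N ⊓ r
  first-term (yes N<r) = trans (cong suc (m≤n⇒m⊓n≡m (<⇒≤ N<r))) (sym (m≤n⇒m⊓n≡m N<r))
  first-term (no N≮r)  =
    trans (m≥n⇒m⊓n≡n (≤-pred (≰⇒> N≮r))) (sym (m≥n⇒m⊓n≡n (m≤n⇒m≤1+n (≤-pred (≰⇒> N≮r)))))

sum-complement : ∀ n (f : ℕ → Bool) → sumTo n (λ i → bit (not (f i))) ≡ n ∸ sumTo n (λ i → bit (f i))
sum-complement n f = begin
    Σnot                            ≡⟨ sym (m+n∸n≡m Σnot Σ) ⟩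
    Σnot + Σ ∸ Σ                    ≡⟨ cong (_∸ Σ) (sym (sum-+ n _ _)) ⟩
    sumTo n (λ i → bit (not (f i)) + bit (f i)) ∸ Σ
                                    ≡⟨ cong (_∸ Σ) (trans (sum-cong n (λ i _ → one (f i))) (sum-ones n)) ⟩
    n ∸ Σ                           ∎
  where
  open ≡-Reasoning
  Σnot = sumTo n (λ i → bit (not (f i)))
  Σ    = sumTo n (λ i → bit (f i))
  one : ∀ y → bit (not y) + bit y ≡ 1
  one true  = refl
  one false = refl

digitCount : ℕ → Bool → Bool → ℕ
digitCount P e x = sum² P (λ a c → bit (does (P ≤? a + c + bit e) == x))

carries-for : ∀ P e a → a < P → sumTo P (λ c → bit (does (P ≤? a + c + bit e))) ≡ a + bit e
carries-for P e a a<P = begin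
    sumTo P (λ c → bit (does (P ≤? a + c + bit e)))
  ≡⟨ sum-cong P (λ c _ → cong (λ s → bit (does (P ≤? s))) (trans (cong (_+ bit e) (+-comm a c)) (+-assoc c a (bit e)))) ⟩
    sumTo P (λ c → bit (does (P ≤? c + (a + bit e))))
  ≡⟨ count-reaching P (a + bit e) ⟩
    P ⊓ (a + bit e)
  ≡⟨ m≥n⇒m⊓n≡n (a+e≤P e) ⟩
    a + bit e ∎
  where
  open ≡-Reasoning
  a+e≤P : ∀ e → a + bit e ≤ P
  a+e≤P true  = subst (_≤ P) (+-comm 1 a) a<P
  a+e≤P false = subst (_≤ P) (sym (+-identityʳ a)) (<⇒≤ a<P)

digitCount-carry : ∀ P e → digitCount P e true ≡ sumTo P (λ a → a + bit e)
digitCount-carry P e = sum-cong P (λ a a<P → carries-for P e a a<P)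

digitCount-no-carry : ∀ P e → digitCount P e false ≡ sumTo P (λ a → P ∸ (a + bit e))
digitCount-no-carry P e = sum-cong P (λ a a<P →
  trans (sum-complement P (λ c → does (P ≤? a + c + bit e))) (cong (P ∸_) (carries-for P e a a<P)))

digitCount-value : ∀ P e x → digitCount P e x ≡ (if does (e Boolₚ.≟ x) then tri P else tri (P ∸ 1))
digitCount-value P true true =
  trans (digitCount-carry P true) (sum-cong P (λ a _ → +-comm a 1))
digitCount-value P false true =
  trans (digitCount-carry P false) (trans (sum-cong P (λ a _ → +-identityʳ a)) (sum-id P))
digitCount-value P true false =
  trans (digitCount-no-carry P true)
    (trans (sum-cong P (λ a _ → cong (P ∸_) (+-comm a 1))) (trans (sum-reversed′ P) (sum-id P)))
digitCount-value P false false =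
  trans (digitCount-no-carry P false) (trans (sum-cong P (λ a _ → cong (P ∸_) (+-identityʳ a))) (sum-reversed P))

weight : ℕ → Bool → List Bool → ℕ
weight P e []      = 1
weight P e (x ∷ w) = digitCount P e x * weight P x w

peel : ∀ (S D : ℕ) s a b →
  S ^ ((if s then 1 else 0) + a) * D ^ ((if s then 0 else 1) + b) ≡ (if s then S else D) * (S ^ a * D ^ b)
peel S D true  a b = *-assoc S (S ^ a) (D ^ b)
peel S D false a b = x*[y*z]≡y*[x*z] (S ^ a) D (D ^ b)

weight-closed : ∀ P e w → weight P e w ≡ tri P ^ nSame (e ∷ w) * tri (P ∸ 1) ^ nDiff (e ∷ w)
weight-closed P e []      = refl
weight-closed P e (x ∷ w) =
  trans (cong₂ _*_ (digitCount-value P e x) (weight-closed P x w))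
        (sym (peel (tri P) (tri (P ∸ 1)) (does (e Boolₚ.≟ x)) (nSame (x ∷ w)) (nDiff (x ∷ w))))

*-≤-remainder : ∀ P Q Y r → r < P → (P * Q ≤ P * Y + r) ⇔ (Q ≤ Y)
*-≤-remainder P Q Y r r<P = mk⇔ to (λ Q≤Y → ≤-trans (*-monoʳ-≤ P Q≤Y) (m≤m+n (P * Y) r))
  where
  to : P * Q ≤ P * Y + r → Q ≤ Y
  to le = s≤s⁻¹ (*-cancelˡ-< P Q (suc Y) (begin-strict
    P * Q        ≤⟨ le ⟩
    P * Y + r    <⟨ +-monoʳ-< (P * Y) r<P ⟩
    P * Y + P    ≡⟨ +-comm (P * Y) P ⟩
    P + P * Y    ≡⟨ sym (*-suc P Y) ⟩
    P * suc Y    ∎))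
    where open ≤-Reasoning

-- Dividing the comparison P·Q ≤ u + P·X by P when u < 2P: u contributes its quotient,
-- which is the carry  P ≤ u.
compare-quotient : ∀ P Q X u → u < P + P → does (P * Q ≤? u + P * X) ≡ does (Q ≤? X + bit (does (P ≤? u)))
compare-quotient P Q X u u<2P = by-carry (P ≤? u)
  where
  via : ∀ r Y → u + P * X ≡ P * Y + r → r < P → (P * Q ≤ u + P * X) ⇔ (Q ≤ Y)
  via r Y eq r<P = subst (λ s → (P * Q ≤ s) ⇔ (Q ≤ Y)) (sym eq) (*-≤-remainder P Q Y r r<P)
  by-carry : (c : Dec (P ≤ u)) → does (P * Q ≤? u + P * X) ≡ does (Q ≤? X + bit (does c))
  by-carry (yes P≤u) = does-⇔ (via (u ∸ P) (X + 1) eq r<P) (P * Q ≤? u + P * X) (Q ≤? X + 1)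
    where
    open +-*-Solver
    r<P : u ∸ P < P
    r<P = +-cancelˡ-< P (u ∸ P) P (subst (_< P + P) (sym (m+[n∸m]≡n P≤u)) u<2P)
    eq : u + P * X ≡ P * (X + 1) + (u ∸ P)
    eq = trans (cong (_+ P * X) (sym (m+[n∸m]≡n P≤u)))
      (solve 3 (λ p r x → p :+ r :+ p :* x := p :* (x :+ con 1) :+ r) refl P (u ∸ P) X)
  by-carry (no P≰u) = does-⇔ (via u (X + 0) eq (≰⇒> P≰u)) (P * Q ≤? u + P * X) (Q ≤? X + 0)
    where
    eq : u + P * X ≡ P * (X + 0) + u
    eq = trans (+-comm u (P * X)) (cong (λ y → P * y + u) (sym (+-identityʳ X)))

≮pred⇔≤+1 : ∀ X Q → 0 < Q → (¬ X < Q ∸ 1) ⇔ (Q ≤ X + 1)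
≮pred⇔≤+1 X (suc Q′) _ = mk⇔
  (λ X≮Q′ → subst (suc Q′ ≤_) (+-comm 1 X) (s≤s (≮⇒≥ X≮Q′)))
  (λ Q≤X+1 → ≤⇒≯ (s≤s⁻¹ (subst (suc Q′ ≤_) (+-comm X 1) Q≤X+1)))

allMatch : (ℕ → Bool) → List Bool → Bool
allMatch f []      = true
allMatch f (x ∷ w) = (f 0 == x) ∧ allMatch (f ∘ suc) w

allMatch-cong : ∀ {f g : ℕ → Bool} → (∀ h → f h ≡ g h) → ∀ w → allMatch f w ≡ allMatch g w
allMatch-cong f≗g []      = refl
allMatch-cong f≗g (x ∷ w) = cong₂ (λ y m → (y == x) ∧ m) (f≗g 0) (allMatch-cong (f≗g ∘ suc) w)

allMatch-snoc : ∀ (f : ℕ → Bool) xs y → allMatch f (xs ++ y ∷ []) ≡ allMatch f xs ∧ (f (length xs) == y)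
allMatch-snoc f []       y = Boolₚ.∧-identityʳ (f 0 == y)
allMatch-snoc f (x ∷ xs) y =
  trans (cong ((f 0 == x) ∧_) (allMatch-snoc (f ∘ suc) xs y)) (sym (Boolₚ.∧-assoc (f 0 == x) _ _))

module Carries (p′ : ℕ) where

  P : ℕ
  P = suc p′

  carry₀ : Bool → ℕ → ℕ → Bool
  carry₀ e i j = does (P ≤? i % P + j % P + bit e)

  carry : Bool → ℕ → ℕ → ℕ → Bool
  carry e h i j = does (P ^ suc h ≤? plus P (suc h) i + plus P (suc h) j + bit e)

  carriesAre : Bool → ℕ → ℕ → List Bool → Bool
  carriesAre e i j []      = true
  carriesAre e i j (x ∷ w) = (carry₀ e i j == x) ∧ carriesAre (carry₀ e i j) (i / P) (j / P) w

  plus-step : ∀ h m → plus P (suc h) m ≡ m % P + P * plus P h (m / P)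
  plus-step zero    m = trans (*-identityʳ (m % P)) (sym (trans (cong (m % P +_) (*-zeroʳ P)) (+-identityʳ _)))
  plus-step (suc h) m = begin
      plus P (suc h) m + digit P h (m / P) * (P * P ^ h)
    ≡⟨ cong (_+ digit P h (m / P) * (P * P ^ h)) (plus-step h m) ⟩
      m % P + P * plus P h (m / P) + digit P h (m / P) * (P * P ^ h)
    ≡⟨ solve 5 (λ a p x d y → a :+ p :* x :+ d :* (p :* y) := a :+ p :* (x :+ d :* y)) refl
         (m % P) P (plus P h (m / P)) (digit P h (m / P)) (P ^ h) ⟩
      m % P + P * (plus P h (m / P) + digit P h (m / P) * P ^ h) ∎
    where
    open ≡-Reasoning
    open +-*-Solver

  plus-small : ∀ h m → m < P ^ h → plus P h m ≡ m
  plus-small zero    zero    _  = refl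
  plus-small zero    (suc m) (s≤s ())
  plus-small (suc h) m       lt = begin
      plus P (suc h) m                ≡⟨ plus-step h m ⟩
      m % P + P * plus P h (m / P)    ≡⟨ cong (λ z → m % P + P * z) (plus-small h (m / P) m/P<P^h) ⟩
      m % P + P * (m / P)             ≡⟨ cong (m % P +_) (*-comm P (m / P)) ⟩
      m % P + m / P * P               ≡⟨ sym (m≡m%n+[m/n]*n m P) ⟩
      m                               ∎
    where
    open ≡-Reasoning
    m/P<P^h : m / P < P ^ h
    m/P<P^h = m<n*o⇒m/o<n (subst (m <_) (*-comm P (P ^ h)) lt)

  carry-zero : ∀ e i j → carry e 0 i j ≡ carry₀ e i j
  carry-zero e i j = cong₂ (λ a s → does (a ≤? s)) (*-identityʳ P)
    (cong₂ (λ a c → a + c + bit e) (*-identityʳ (i % P)) (*-identityʳ (j % P)))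

  digits+carry<2P : ∀ e i j → i % P + j % P + bit e < P + P
  digits+carry<2P e i j = begin-strict
      i % P + j % P + bit e    ≤⟨ +-monoʳ-≤ (i % P + j % P) (bit≤1 e) ⟩
      i % P + j % P + 1        ≡⟨ +-assoc (i % P) (j % P) 1 ⟩
      i % P + (j % P + 1)      <⟨ +-mono-<-≤ (m%n<n i P) (subst (_≤ P) (+-comm 1 (j % P)) (m%n<n j P)) ⟩
      P + P                    ∎
    where
    open ≤-Reasoning
    bit≤1 : ∀ e → bit e ≤ 1
    bit≤1 true  = ≤-refl
    bit≤1 false = z≤n

  carry-suc : ∀ e h i j → carry e (suc h) i j ≡ carry (carry₀ e i j) h (i / P) (j / P)
  carry-suc e h i j = begin
      does (P * P ^ suc h ≤? plus P (suc (suc h)) i + plus P (suc (suc h)) j + bit e)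
    ≡⟨ cong (λ s → does (P * P ^ suc h ≤? s)) regroup ⟩
      does (P * P ^ suc h ≤? u + P * (A + B))
    ≡⟨ compare-quotient P (P ^ suc h) (A + B) u (digits+carry<2P e i j) ⟩
      carry (carry₀ e i j) h (i / P) (j / P) ∎
    where
    open ≡-Reasoning
    open +-*-Solver
    A = plus P (suc h) (i / P)
    B = plus P (suc h) (j / P)
    u = i % P + j % P + bit e
    regroup : plus P (suc (suc h)) i + plus P (suc (suc h)) j + bit e ≡ u + P * (A + B)
    regroup = trans (cong₂ (λ a c → a + c + bit e) (plus-step (suc h) i) (plus-step (suc h) j))
      (solve 6 (λ a c p x y e → a :+ p :* x :+ (c :+ p :* y) :+ e := a :+ c :+ e :+ p :* (x :+ y)) refl
        (i % P) (j % P) P A B (bit e))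

  carriesAre-allMatch : ∀ e i j w → carriesAre e i j w ≡ allMatch (λ h → carry e h i j) w
  carriesAre-allMatch e i j []      = refl
  carriesAre-allMatch e i j (x ∷ w) = cong₂ (λ y m → (y == x) ∧ m) (sym (carry-zero e i j))
    (trans (carriesAre-allMatch (carry₀ e i j) (i / P) (j / P) w)
           (allMatch-cong (λ h → sym (carry-suc e h i j)) w))

  bh-carry : ∀ h i j → bh P h i j ≡ carry true h i j
  bh-carry h i j = does-⇔ (≮pred⇔≤+1 X Q (m^n>0 P (suc h))) (¬? (X <? Q ∸ 1)) (Q ≤? X + 1)
    where
    Q = P ^ suc h
    X = plus P (suc h) i + plus P (suc h) j

  carry-top : ∀ e N i j → i < P ^ suc N → j < P ^ suc N → carry e N i j ≡ does (P ^ suc N ≤? i + j + bit e)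
  carry-top e N i j i< j< =
    cong₂ (λ a c → does (P ^ suc N ≤? a + c + bit e)) (plus-small (suc N) i i<) (plus-small (suc N) j j<)

  mod-digit : ∀ a i → a < P → (a + i * P) % P ≡ a
  mod-digit a i a<P = trans ([m+kn]%n≡m%n a i P) (m<n⇒m%n≡m a<P)

  div-digit : ∀ a i → a < P → (a + i * P) / P ≡ i
  div-digit a i a<P = trans (+-distrib-/ a (i * P) digits<P) (cong₂ _+_ (m<n⇒m/n≡0 a<P) (m*n/n≡m i P))
    where
    digits<P : a % P + (i * P) % P < P
    digits<P = subst (_< P) (sym (trans (cong₂ _+_ (m<n⇒m%n≡m a<P) (m*n%n≡0 i P)) (+-identityʳ a))) a<P

  carriesAre-digits : ∀ e x w a c i j → a < P → c < P →
    bit (carriesAre e (a + i * P) (c + j * P) (x ∷ w))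
      ≡ bit (does (P ≤? a + c + bit e) == x) * bit (carriesAre x i j w)
  carriesAre-digits e x w a c i j a<P c<P = begin
      bit ((carry₀ e I J == x) ∧ carriesAre (carry₀ e I J) (I / P) (J / P) w)
    ≡⟨ cong (λ y → bit ((y == x) ∧ carriesAre y (I / P) (J / P) w)) units ⟩
      bit ((y == x) ∧ carriesAre y (I / P) (J / P) w)
    ≡⟨ cong₂ (λ i′ j′ → bit ((y == x) ∧ carriesAre y i′ j′ w)) (div-digit a i a<P) (div-digit c j c<P) ⟩
      bit ((y == x) ∧ carriesAre y i j w)
    ≡⟨ bit-==-∧ y x (λ y → carriesAre y i j w) ⟩
      bit (y == x) * bit (carriesAre x i j w) ∎
    where
    open ≡-Reasoning
    I = a + i * P
    J = c + j * P
    y = does (P ≤? a + c + bit e)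
    units : carry₀ e I J ≡ y
    units = cong₂ (λ a′ c′ → does (P ≤? a′ + c′ + bit e)) (mod-digit a i a<P) (mod-digit c j c<P)

  count-carries : ∀ e w → sum² (P ^ length w) (λ i j → bit (carriesAre e i j w)) ≡ weight P e w
  count-carries e []      = refl
  count-carries e (x ∷ w) = begin
      sum² (P * K) f
    ≡⟨ cong (λ n → sum² n f) (*-comm P K) ⟩
      sum² (K * P) f
    ≡⟨ sum²-blocks K P f ⟩
      sum² K (λ i j → sum² P (λ a c → f (a + i * P) (c + j * P)))
    ≡⟨ sum²-cong K (λ i j _ _ → sum²-cong P (λ a c a<P c<P → carriesAre-digits e x w a c i j a<P c<P)) ⟩
      sum² K (λ i j → sum² P (λ a c → bit (does (P ≤? a + c + bit e) == x) * bit (carriesAre x i j w)))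
    ≡⟨ sum²-product K P (λ a c → bit (does (P ≤? a + c + bit e) == x)) (λ i j → bit (carriesAre x i j w)) ⟩
      digitCount P e x * sum² K (λ i j → bit (carriesAre x i j w))
    ≡⟨ cong (digitCount P e x *_) (count-carries x w) ⟩
      weight P e (x ∷ w) ∎
    where
    open ≡-Reasoning
    K = P ^ length w
    f : ℕ → ℕ → ℕ
    f i j = bit (carriesAre e i j (x ∷ w))

lastEntry : ∀ {n} → Vec Bool (suc n) → Bool
lastEntry (x ∷ᵥ []ᵥ)      = x
lastEntry (x ∷ᵥ (y ∷ᵥ v)) = lastEntry (y ∷ᵥ v)

does-≟ : ∀ y x → does (y Boolₚ.≟ x) ≡ y == x
does-≟ true  true  = refl
does-≟ true  false = refl
does-≟ false true  = refl
does-≟ false false = refl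

tabulate-matches : ∀ N (f : ℕ → Bool) t (b : Vec Bool (suc N)) →
  does (Vecₚ.≡-dec Boolₚ._≟_ (tabulate (λ (h : Fin (suc N)) → if does (suc (toℕ h) ≤? N) then f (toℕ h) else t)) b)
    ≡ allMatch f (take N (toList b)) ∧ (t == lastEntry b)
tabulate-matches zero    f t (y ∷ᵥ []ᵥ)      = trans (Boolₚ.∧-identityʳ _) (does-≟ t y)
tabulate-matches (suc N) f t (y ∷ᵥ (z ∷ᵥ b)) = begin
    does (f 0 Boolₚ.≟ y) ∧ does (Vecₚ.≡-dec Boolₚ._≟_ (tabulate (entry ∘ fsuc)) (z ∷ᵥ b))
  ≡⟨ cong₂ _∧_ (does-≟ (f 0) y) (cong (λ v → does (Vecₚ.≡-dec Boolₚ._≟_ v (z ∷ᵥ b))) (Vecₚ.tabulate-cong shift)) ⟩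
    (f 0 == y) ∧ does (Vecₚ.≡-dec Boolₚ._≟_ (tabulate entry′) (z ∷ᵥ b))
  ≡⟨ cong ((f 0 == y) ∧_) (tabulate-matches N (f ∘ suc) t (z ∷ᵥ b)) ⟩
    (f 0 == y) ∧ (allMatch (f ∘ suc) (take N (toList (z ∷ᵥ b))) ∧ (t == lastEntry (z ∷ᵥ b)))
  ≡⟨ sym (Boolₚ.∧-assoc (f 0 == y) _ _) ⟩
    ((f 0 == y) ∧ allMatch (f ∘ suc) (take N (toList (z ∷ᵥ b)))) ∧ (t == lastEntry (z ∷ᵥ b)) ∎
  where
  open ≡-Reasoning
  entry : Fin (suc (suc N)) → Bool
  entry h = if does (suc (toℕ h) ≤? suc N) then f (toℕ h) else t
  entry′ : Fin (suc N) → Bool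
  entry′ h = if does (suc (toℕ h) ≤? N) then f (suc (toℕ h)) else t
  shift : ∀ h → entry (fsuc h) ≡ entry′ h
  shift h = cong (λ c → if c then f (suc (toℕ h)) else t) (≤?-suc (suc (toℕ h)) N)

one-of-two : ∀ A l → bit (A ∧ (true == l)) + bit (A ∧ (false == l)) ≡ bit A
one-of-two true  true  = refl
one-of-two true  false = refl
one-of-two false l     = refl

module Dimension (p′ N : ℕ) (b : Vec Bool (suc N)) where

  open Carries p′

  q : ℕ
  q = P ^ suc N

  prefix : List Bool
  prefix = take N (toList b)

  -- The carry sequence sought: b_0 , … , b_{N-1} and no carry out of the top digit.
  w : List Bool
  w = prefix ++ false ∷ []

  length-prefix : length prefix ≡ N
  length-prefix = trans (Listₚ.length-take N (toList b))
    (trans (cong (N ⊓_) (Vecₚ.length-toList b)) (m≤n⇒m⊓n≡m (n≤1+n N)))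

  length-w : length w ≡ suc N
  length-w = trans (Listₚ.length-++ prefix) (trans (cong (_+ 1) length-prefix) (+-comm N 1))

  prefixMatch : ℕ × ℕ → Bool
  prefixMatch (i , j) = allMatch (λ h → bh P h i j) prefix

  matches : Bool × (ℕ × ℕ) → Bool
  matches e = does (Vecₚ.≡-dec Boolₚ._≟_ (basisVec P (suc N) e) b)

  dim-as-count : dimPiece P (suc N) b ≡ count prefixMatch (Δ q)
  dim-as-count = begin
      dimPiece P (suc N) b
    ≡⟨ count-filter (λ e → Vecₚ.≡-dec Boolₚ._≟_ (basisVec P (suc N) e) b) (Basis q) ⟩
      count matches (Basis q)
    ≡⟨ count-++ matches (map (true ,_) (Δ q)) (map (false ,_) (Δ q)) ⟩
      count matches (map (true ,_) (Δ q)) + count matches (map (false ,_) (Δ q))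
    ≡⟨ cong₂ _+_ (count-map matches (true ,_) (Δ q)) (count-map matches (false ,_) (Δ q)) ⟩
      count (matches ∘ (true ,_)) (Δ q) + count (matches ∘ (false ,_)) (Δ q)
    ≡⟨ count-merge _ _ prefixMatch one-matches (Δ q) ⟩
      count prefixMatch (Δ q) ∎
    where
    open ≡-Reasoning
    one-matches : ∀ ij → bit (matches (true , ij)) + bit (matches (false , ij)) ≡ bit (prefixMatch ij)
    one-matches (i , j) = trans
      (cong₂ (λ m m′ → bit m + bit m′) (tabulate-matches N (λ h → bh P h i j) true b)
                                        (tabulate-matches N (λ h → bh P h i j) false b))
      (one-of-two (prefixMatch (i , j)) (lastEntry b))

  carriesAre-w : ∀ i j → carriesAre true i j w ≡ prefixMatch (i , j) ∧ not (carry true N i j)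
  carriesAre-w i j = begin
      carriesAre true i j w
    ≡⟨ carriesAre-allMatch true i j w ⟩
      allMatch (λ h → carry true h i j) w
    ≡⟨ allMatch-snoc (λ h → carry true h i j) prefix false ⟩
      allMatch (λ h → carry true h i j) prefix ∧ not (carry true (length prefix) i j)
    ≡⟨ cong₂ (λ m h → m ∧ not (carry true h i j))
         (allMatch-cong (λ h → sym (bh-carry h i j)) prefix) length-prefix ⟩
      prefixMatch (i , j) ∧ not (carry true N i j) ∎
    where open ≡-Reasoning

  carriesAre-inside : ∀ i j → i < q → j < q → i + j < q ∸ 1 → carriesAre true i j w ≡ prefixMatch (i , j)
  carriesAre-inside i j i<q j<q i+j<q-1 = trans (carriesAre-w i j) (trans
    (cong (λ c → prefixMatch (i , j) ∧ not c) (trans (carry-top true N i j i<q j<q) (dec-false (q ≤? i + j + 1) q≰)))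
    (Boolₚ.∧-identityʳ _))
    where
    q≰ : ¬ (q ≤ i + j + 1)
    q≰ = <⇒≱ (m≤o∸n⇒m+n≤o (suc (i + j)) (m^n>0 P (suc N)) i+j<q-1)

  carriesAre-outside : ∀ i j → i < q → j < q → q ∸ 1 ≤ i + j → carriesAre true i j w ≡ false
  carriesAre-outside i j i<q j<q q-1≤i+j = trans (carriesAre-w i j) (trans
    (cong (λ c → prefixMatch (i , j) ∧ not c) (trans (carry-top true N i j i<q j<q) (dec-true (q ≤? i + j + 1) q≤)))
    (Boolₚ.∧-zeroʳ _))
    where
    q≤ : q ≤ i + j + 1
    q≤ = ≤-trans (m≤n+m∸n q 1) (subst (1 + (q ∸ 1) ≤_) (+-comm 1 (i + j)) (+-monoʳ-≤ 1 q-1≤i+j))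

  dim-as-carries : dimPiece P (suc N) b ≡ sum² q (λ i j → bit (carriesAre true i j w))
  dim-as-carries = begin
      dimPiece P (suc N) b
    ≡⟨ dim-as-count ⟩
      count prefixMatch (Δ q)
    ≡⟨ count-Δ prefixMatch q ⟩
      sumTo (q ∸ 1) (λ i → sumTo (q ∸ 1 ∸ i) (λ j → bit (prefixMatch (i , j))))
    ≡⟨ sum²-triangle q (λ i j → bit (carriesAre true i j w)) (λ i j → bit (prefixMatch (i , j)))
         (λ i j i<q j<q inside → cong bit (sym (carriesAre-inside i j i<q j<q inside)))
         (λ i j i<q j<q outside → cong bit (carriesAre-outside i j i<q j<q outside)) ⟩
      sum² q (λ i j → bit (carriesAre true i j w)) ∎
    where open ≡-Reasoning

  dimension : dimPiece P (suc N) b ≡ tri P ^ nSame (true ∷ w) * tri p′ ^ nDiff (true ∷ w)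
  dimension = begin
      dimPiece P (suc N) b
    ≡⟨ dim-as-carries ⟩
      sum² (P ^ suc N) (λ i j → bit (carriesAre true i j w))
    ≡⟨ cong (λ k → sum² (P ^ k) (λ i j → bit (carriesAre true i j w))) (sym length-w) ⟩
      sum² (P ^ length w) (λ i j → bit (carriesAre true i j w))
    ≡⟨ count-carries true w ⟩
      weight P true w
    ≡⟨ weight-closed P true w ⟩
      tri P ^ nSame (true ∷ w) * tri p′ ^ nDiff (true ∷ w) ∎
    where open ≡-Reasoning

lemma4p2 : (p n : ℕ) → Prime p → 2 ≤ n → (b : Vec Bool n) →
    dimPiece p n b ≡
      ((p * (p + 1)) / 2) ^ nSame (aug n b) * ((p * (p ∸ 1)) / 2) ^ nDiff (aug n b)
lemma4p2 zero     n             p-prime _               b = ⊥-elim (≢-nonZero⁻¹ 0 {{prime⇒nonZero p-prime}} refl)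
lemma4p2 (suc p′) (suc (suc m)) _       (s≤s (s≤s _)) b = trans (Dimension.dimension p′ (suc m) b)
  (sym (cong₂ (λ s d → s ^ nSame (aug (suc (suc m)) b) * d ^ nDiff (aug (suc (suc m)) b))
              (tri-above (suc p′)) (tri-below (suc p′))))
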